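{- For every positive integer $n$, there exists at least one W-path of order $n$.
   Context: Take an equilateral triangle with corners $A$ (bottom-left), $B$ (bottom-right) and $C$ (top), and divide each side into $n$ equal parts of unit length; the segments through the division points parallel to the sides partition it into $n^2$ unit subtriangles, of which the $T_n=n(n+1)/2$ upward-facing ones are the dark tiles. The inscribed grid is the set of centroids of the dark tiles, two centroids being adjacent when at unit distance (it forms a triangular grid). Direction code: a directed segment at angle $d\pi/3$ counterclockwise from the direction of $AB$ has code $d\in\{0,\dots,5\}$. An H-path is a Hamiltonian path on the inscribed grid using edges between adjacent centroids, from the centroid of the dark tile at $A$ to the centroid of the dark tile at $B$, described by the string $d_1\cdots d_{T_n-1}$ of direction codes of its edges. A W-path is an H-path such that in the supplemented string $e_0e_1\cdots e_{T_n}=0\,d_1\cdots d_{T_n-1}\,0$, every consecutive pair satisfies $e_{i+1}\not\equiv e_i+4\pmod 6$ when $e_i$ is even and $e_{i+1}\not\equiv e_i+2\pmod 6$ when $e_i$ is odd. -}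

module Defs where

open import Data.Nat using (ℕ; zero; suc; _∸_; _%_) renaming (_+_ to _+ℕ_)
open import Data.Fin using (Fin; toℕ)
open import Data.Integer using (ℤ; +_; -[1+_]; _+_; _≤_; _<_; 0ℤ)
open import Data.Product using (_×_; _,_)
open import Data.List using (List; []; _∷_; _++_; [_]; last)
open import Data.Maybe using (just)
open import Data.Unit using (⊤)
open import Data.List.Relation.Unary.All using (All)
open import Data.List.Relation.Unary.Unique.Propositional using (Unique)
open import Data.List.Membership.Propositional using (_∈_)
open import Relation.Binary.PropositionalEquality using (_≡_; _≢_)

-- Coordinates: a point of the inscribed grid is written (x , y), meaning
-- the centroid of the dark tile whose lower-left corner is A + x·u₀ + y·u₁,
-- where u₀ is the unit vector in direction AB (code 0) and u₁ the unit
-- vector at angle π/3 (code 1).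
Point : Set
Point = ℤ × ℤ

InGrid : ℕ → Point → Set
InGrid n (x , y) = (0ℤ ≤ x) × (0ℤ ≤ y) × (x + y < + n)

-- Unit displacement of direction code d (angle dπ/3 from AB), in (u₀,u₁)
-- coordinates:  0:(1,0) 1:(0,1) 2:(-1,1) 3:(-1,0) 4:(0,-1) 5:(1,-1).
-- These are exactly the vectors of unit length between grid points.
step : Fin 6 → Point
step Fin.zero = (+ 1 , + 0)
step (Fin.suc Fin.zero) = (+ 0 , + 1)
step (Fin.suc (Fin.suc Fin.zero)) = (-[1+ 0 ] , + 1)
step (Fin.suc (Fin.suc (Fin.suc Fin.zero))) = (-[1+ 0 ] , + 0)
step (Fin.suc (Fin.suc (Fin.suc (Fin.suc Fin.zero)))) = (+ 0 , -[1+ 0 ])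
step (Fin.suc (Fin.suc (Fin.suc (Fin.suc (Fin.suc Fin.zero))))) = (+ 1 , -[1+ 0 ])

_⊕_ : Point → Point → Point
(a , b) ⊕ (c , d) = (a + c , b + d)

walk : Point → List (Fin 6) → List Point
walk p [] = p ∷ []
walk p (d ∷ ds) = p ∷ walk (p ⊕ step d) ds

cornerA : Point
cornerA = (+ 0 , + 0)

cornerB : ℕ → Point
cornerB n = (+ (n ∸ 1) , + 0)

-- H-path of order n given by its direction string d₁⋯d_{T_n - 1}:
-- a path in the grid (consecutive points adjacent by construction),
-- starting at A's tile, visiting every grid point, no point twice,
-- ending at B's tile.
HPath : ℕ → List (Fin 6) → Set
HPath n ds =
  All (InGrid n) (walk cornerA ds) ×
  Unique (walk cornerA ds) ×
  (∀ p → InGrid n p → p ∈ walk cornerA ds) ×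
  (last (walk cornerA ds) ≡ just (cornerB n))

OkPair : Fin 6 → Fin 6 → Set
OkPair a b with toℕ a % 2
... | 0 = toℕ b ≢ (toℕ a +ℕ 4) % 6
... | _ = toℕ b ≢ (toℕ a +ℕ 2) % 6

Consecutive : {A : Set} → (A → A → Set) → List A → Set
Consecutive R [] = ⊤
Consecutive R (a ∷ []) = ⊤
Consecutive R (a ∷ b ∷ xs) = R a b × Consecutive R (b ∷ xs)

supplement : List (Fin 6) → List (Fin 6)
supplement ds = Fin.zero ∷ (ds ++ [ Fin.zero ])

WPath : ℕ → List (Fin 6) → Set
WPath n ds = HPath n ds × Consecutive OkPair (supplement ds)

-- The path sweeps the triangle column by column, boustrophedon fashion: up the
-- column x = 0 (code 1), diagonally down-right onto the top of column 1 (code 5),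
-- down it (code 4), right onto the foot of column 2 (code 0), and so on, ending in
-- the single cell of column n − 1, which is B.  Consecutive column heights differ
-- by one, which is exactly what makes the moves 5 and 0 land on the next column.
-- The only turns occurring in the supplemented string are 01, 11, 15, 54, 44, 40,
-- 00 and 50, none of which is forbidden.
module Submission where

open import Defs
open import Data.Nat using (ℕ; _≤_)
open import Data.Fin using (Fin)
open import Data.List using (List)
open import Data.Product using (∃)

open import Data.Nat using (zero; suc; _+_; _<_; z≤n; s≤s)
open import Data.Nat.Properties
  using (+-comm; +-identityʳ; +-suc; ≤-refl; ≤-reflexive; ≤-trans; n≤1+n; <-irrefl; <⇒≱; ≤-pred;
         m≤n⇒m<n∨m≡n; +-cancelˡ-≤; m+n≤o⇒m≤o; +-monoʳ-≤)
open import Data.Fin using (#_)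
open import Data.List using ([]; _∷_; _++_; [_]; _∷ʳ_; last; map; replicate; upTo; downFrom)
open import Data.List.Properties using (map-++; ++-assoc; upTo-∷ʳ; last-map)
open import Data.Product using (_×_; _,_; proj₂)
open import Data.Maybe using (just)
import Data.Maybe as Maybe
open import Data.Sum using (inj₁; inj₂)
open import Data.Integer using (+_; +≤+; +<+)
open import Data.Unit using (tt)
open import Data.Empty using (⊥-elim)
open import Data.List.Relation.Unary.All using (All)
import Data.List.Relation.Unary.All as All
import Data.List.Relation.Unary.All.Properties as All
open import Data.List.Relation.Unary.Unique.Propositional using (Unique)
import Data.List.Relation.Unary.Unique.Propositional.Properties as Unique
open import Data.List.Relation.Binary.Disjoint.Propositional using (Disjoint)
open import Data.List.Membership.Propositional using (_∈_)
open import Data.List.Membership.Propositional.Properties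
  using (∈-map⁺; ∈-map⁻; ∈-++⁺ˡ; ∈-++⁺ʳ; ∈-++⁻; ∈-upTo⁺; ∈-upTo⁻; ∈-downFrom⁺; ∈-downFrom⁻)
open import Relation.Binary.PropositionalEquality
  using (_≡_; refl; sym; trans; cong; cong₂; subst; module ≡-Reasoning)

replicate-++-∷ : ∀ {A : Set} k (a : A) xs → replicate (suc k) a ++ xs ≡ replicate k a ++ a ∷ xs
replicate-++-∷ zero    a xs = refl
replicate-++-∷ (suc k) a xs = cong (a ∷_) (replicate-++-∷ k a xs)

last-++ : ∀ {A : Set} (xs : List A) {ys} {y} → last ys ≡ just y → last (xs ++ ys) ≡ just y
last-++ []                    eq = eq
last-++ (x ∷ [])     {[]}    ()
last-++ (x ∷ [])     {_ ∷ _} eq = eq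
last-++ (x ∷ x′ ∷ xs)        eq = last-++ (x′ ∷ xs) eq

consecutive-replicate : ∀ {A : Set} {R : A → A → Set} {a} k {xs} →
  R a a → Consecutive R (a ∷ xs) → Consecutive R (a ∷ replicate k a ++ xs)
consecutive-replicate zero    Raa c = c
consecutive-replicate (suc k) Raa c = Raa , consecutive-replicate k Raa c

Cell : Set
Cell = ℕ × ℕ

point : Cell → Point
point (a , b) = (+ a , + b)

point-injective : ∀ {p q : Cell} → point p ≡ point q → p ≡ q
point-injective {_ , _} {_ , _} refl = refl

⊕-east : ∀ a b → point (a , b) ⊕ step (# 0) ≡ point (suc a , b)
⊕-east a b = cong₂ _,_ (cong +_ (+-comm a 1)) (cong +_ (+-identityʳ b))

⊕-north : ∀ a b → point (a , b) ⊕ step (# 1) ≡ point (a , suc b)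
⊕-north a b = cong₂ _,_ (cong +_ (+-identityʳ a)) (cong +_ (+-comm b 1))

⊕-south : ∀ a b → point (a , suc b) ⊕ step (# 4) ≡ point (a , b)
⊕-south a b = cong₂ _,_ (cong +_ (+-identityʳ a)) refl

⊕-southeast : ∀ a b → point (a , suc b) ⊕ step (# 5) ≡ point (suc a , b)
⊕-southeast a b = cong₂ _,_ (cong +_ (+-comm a 1)) refl

data Heading : Set where
  up down : Heading

turn : Heading → Heading
turn up   = down
turn down = up

column : Heading → ℕ → ℕ → List Cell
column up   x h = map (x ,_) (upTo h)
column down x h = map (x ,_) (downFrom h)

sweep : Heading → ℕ → ℕ → List Cell
sweep o x zero    = column o x 1
sweep o x (suc h) = column o x (suc (suc h)) ++ sweep (turn o) (suc x) h

vertical exit : Heading → Fin 6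
vertical up   = # 1
vertical down = # 4
exit up   = # 5
exit down = # 0

strokes : Heading → ℕ → List (Fin 6)
strokes o zero    = []
strokes o (suc h) = replicate (suc h) (vertical o) ++ exit o ∷ strokes (turn o) h

foot : Heading → ℕ → ℕ → Cell
foot up   x h = (x , 0)
foot down x h = (x , h)

column-up-snoc : ∀ x h ys →
  map point (column up x h) ++ point (x , h) ∷ ys ≡ map point (column up x (suc h)) ++ ys
column-up-snoc x h ys = begin
  map point (column up x h) ++ [ point (x , h) ] ++ ys
    ≡⟨ sym (++-assoc (map point (column up x h)) _ ys) ⟩
  (map point (column up x h) ++ [ point (x , h) ]) ++ ys
    ≡⟨ cong (_++ ys) (sym (map-++ point (column up x h) _)) ⟩
  map point (column up x h ++ [ (x , h) ]) ++ ys
    ≡⟨ cong (λ l → map point l ++ ys) (sym (map-++ (x ,_) (upTo h) _)) ⟩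
  map point (map (x ,_) (upTo h ∷ʳ h)) ++ ys
    ≡⟨ cong (λ l → map point (map (x ,_) l) ++ ys) (upTo-∷ʳ h) ⟩
  map point (column up x (suc h)) ++ ys ∎
  where open ≡-Reasoning

walk-north : ∀ x h r →
  walk (point (x , 0)) (replicate h (# 1) ++ r) ≡ map point (column up x h) ++ walk (point (x , h)) r
walk-north x zero    r = refl
walk-north x (suc h) r = begin
  walk (point (x , 0)) (replicate (suc h) (# 1) ++ r)
    ≡⟨ cong (walk _) (replicate-++-∷ h (# 1) r) ⟩
  walk (point (x , 0)) (replicate h (# 1) ++ # 1 ∷ r)
    ≡⟨ walk-north x h (# 1 ∷ r) ⟩
  map point (column up x h) ++ point (x , h) ∷ walk (point (x , h) ⊕ step (# 1)) r
    ≡⟨ cong (λ p → map point (column up x h) ++ point (x , h) ∷ walk p r) (⊕-north x h) ⟩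
  map point (column up x h) ++ point (x , h) ∷ walk (point (x , suc h)) r
    ≡⟨ column-up-snoc x h _ ⟩
  map point (column up x (suc h)) ++ walk (point (x , suc h)) r ∎
  where open ≡-Reasoning

walk-south : ∀ x h r →
  walk (point (x , h)) (replicate h (# 4) ++ # 0 ∷ r)
    ≡ map point (column down x (suc h)) ++ walk (point (suc x , 0)) r
walk-south x zero    r = cong (λ p → point (x , 0) ∷ walk p r) (⊕-east x 0)
walk-south x (suc h) r = cong (point (x , suc h) ∷_) (trans
  (cong (λ p → walk p (replicate h (# 4) ++ # 0 ∷ r)) (⊕-south x h))
  (walk-south x h r))

walk-column : ∀ o x h r →
  walk (point (foot o x (suc h))) (replicate (suc h) (vertical o) ++ exit o ∷ r)
    ≡ map point (column o x (suc (suc h))) ++ walk (point (foot (turn o) (suc x) h)) r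
walk-column up x h r = begin
  walk (point (x , 0)) (replicate (suc h) (# 1) ++ # 5 ∷ r)
    ≡⟨ walk-north x (suc h) (# 5 ∷ r) ⟩
  map point (column up x (suc h)) ++ point (x , suc h) ∷ walk (point (x , suc h) ⊕ step (# 5)) r
    ≡⟨ cong (λ p → map point (column up x (suc h)) ++ point (x , suc h) ∷ walk p r) (⊕-southeast x h) ⟩
  map point (column up x (suc h)) ++ point (x , suc h) ∷ walk (point (suc x , h)) r
    ≡⟨ column-up-snoc x (suc h) _ ⟩
  map point (column up x (suc (suc h))) ++ walk (point (suc x , h)) r ∎
  where open ≡-Reasoning
walk-column down x h r = walk-south x (suc h) r

walk-strokes : ∀ o x h → walk (point (foot o x h)) (strokes o h) ≡ map point (sweep o x h)
walk-strokes up   x zero    = refl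
walk-strokes down x zero    = refl
walk-strokes o    x (suc h) = begin
  walk (point (foot o x (suc h))) (strokes o (suc h))
    ≡⟨ walk-column o x h _ ⟩
  map point (column o x (suc (suc h))) ++ walk (point (foot (turn o) (suc x) h)) (strokes (turn o) h)
    ≡⟨ cong (map point (column o x (suc (suc h))) ++_) (walk-strokes (turn o) (suc x) h) ⟩
  map point (column o x (suc (suc h))) ++ map point (sweep (turn o) (suc x) h)
    ≡⟨ sym (map-++ point (column o x (suc (suc h))) _) ⟩
  map point (sweep o x (suc h)) ∎
  where open ≡-Reasoning

Triangle : ℕ → ℕ → Cell → Set
Triangle x h (a , b) = x ≤ a × a + b ≤ x + h

∈-column⁻ : ∀ o {x h a b} → (a , b) ∈ column o x h → a ≡ x × b < h
∈-column⁻ up   ab∈ with _ , y∈ , refl ← ∈-map⁻ _ ab∈ = refl , ∈-upTo⁻ y∈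
∈-column⁻ down ab∈ with _ , y∈ , refl ← ∈-map⁻ _ ab∈ = refl , ∈-downFrom⁻ y∈

∈-column⁺ : ∀ o {x h b} → b < h → (x , b) ∈ column o x h
∈-column⁺ up   b<h = ∈-map⁺ _ (∈-upTo⁺ b<h)
∈-column⁺ down b<h = ∈-map⁺ _ (∈-downFrom⁺ b<h)

column-unique : ∀ o x h → Unique (column o x h)
column-unique up   x h = Unique.map⁺ (cong proj₂) (Unique.upTo⁺ h)
column-unique down x h = Unique.map⁺ (cong proj₂) (Unique.downFrom⁺ h)

sweep-⊆-triangle : ∀ o x h {q} → q ∈ sweep o x h → Triangle x h q
sweep-⊆-triangle o x zero    q∈ with refl , s≤s z≤n ← ∈-column⁻ o q∈ = ≤-refl , ≤-refl
sweep-⊆-triangle o x (suc h) q∈ with ∈-++⁻ (column o x (suc (suc h))) q∈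
... | inj₁ q∈column with refl , b<h+2 ← ∈-column⁻ o q∈column = ≤-refl , +-monoʳ-≤ x (≤-pred b<h+2)
... | inj₂ q∈rest with x<a , le ← sweep-⊆-triangle (turn o) (suc x) h q∈rest =
  ≤-trans (n≤1+n x) x<a , ≤-trans le (≤-reflexive (sym (+-suc x h)))

triangle-⊆-sweep : ∀ o x h {q} → Triangle x h q → q ∈ sweep o x h
triangle-⊆-sweep o x h {a , b} (x≤a , le) with m≤n⇒m<n∨m≡n x≤a
... | inj₂ refl = column-⊆-sweep h (∈-column⁺ o (s≤s (+-cancelˡ-≤ x b h le)))
  where
  column-⊆-sweep : ∀ h {q} → q ∈ column o x (suc h) → q ∈ sweep o x h
  column-⊆-sweep zero    q∈ = q∈
  column-⊆-sweep (suc h) q∈ = ∈-++⁺ˡ q∈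
triangle-⊆-sweep o x zero    (_ , le) | inj₁ x<a =
  ⊥-elim (<⇒≱ x<a (m+n≤o⇒m≤o _ (≤-trans le (≤-reflexive (+-identityʳ x)))))
triangle-⊆-sweep o x (suc h) (_ , le) | inj₁ x<a =
  ∈-++⁺ʳ _ (triangle-⊆-sweep (turn o) (suc x) h (x<a , ≤-trans le (≤-reflexive (+-suc x h))))

sweep-unique : ∀ o x h → Unique (sweep o x h)
sweep-unique o x zero    = column-unique o x 1
sweep-unique o x (suc h) =
  Unique.++⁺ (column-unique o x (suc (suc h))) (sweep-unique (turn o) (suc x) h) disjoint
  where
  disjoint : Disjoint (column o x (suc (suc h))) (sweep (turn o) (suc x) h)
  disjoint {_ , _} (q∈column , q∈rest)
    with refl , _ ← ∈-column⁻ o q∈column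
       | x<x , _ ← sweep-⊆-triangle (turn o) (suc x) h q∈rest = <-irrefl refl x<x

sweep-last : ∀ o x h → last (sweep o x h) ≡ just (h + x , 0)
sweep-last up   x zero    = refl
sweep-last down x zero    = refl
sweep-last o    x (suc h) =
  last-++ (column o x (suc (suc h)))
    (trans (sweep-last (turn o) (suc x) h) (cong (λ a → just (a , 0)) (+-suc h x)))

strokes-turns : ∀ o h → Consecutive OkPair (exit (turn o) ∷ strokes o h ++ [ # 0 ])
strokes-turns up   zero = (λ ()) , tt
strokes-turns down zero = (λ ()) , tt
strokes-turns up   (suc h) rewrite ++-assoc (replicate (suc h) (# 1)) (# 5 ∷ strokes down h) [ # 0 ] =
  (λ ()) , consecutive-replicate h (λ ()) ((λ ()) , strokes-turns down h)
strokes-turns down (suc h) rewrite ++-assoc (replicate (suc h) (# 4)) (# 0 ∷ strokes up h) [ # 0 ] =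
  (λ ()) , consecutive-replicate h (λ ()) ((λ ()) , strokes-turns up h)

triangle-in-grid : ∀ h {q} → Triangle 0 h q → InGrid (suc h) (point q)
triangle-in-grid h {_ , _} (_ , le) = +≤+ z≤n , +≤+ z≤n , +<+ (s≤s le)

grid-⊆-sweep : ∀ h p → InGrid (suc h) p → p ∈ map point (sweep up 0 h)
grid-⊆-sweep h (+ a , + b) (+≤+ _ , +≤+ _ , +<+ (s≤s le)) =
  ∈-map⁺ point (triangle-⊆-sweep up 0 h (z≤n , le))

mainTheorem2 : (n : ℕ) → 1 ≤ n → ∃ (λ (ds : List (Fin 6)) → WPath n ds)
mainTheorem2 (suc h) _ = strokes up h , hamiltonian , strokes-turns up h
  where
  visits : walk cornerA (strokes up h) ≡ map point (sweep up 0 h)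
  visits = walk-strokes up 0 h

  ends-at-B : last (map point (sweep up 0 h)) ≡ just (cornerB (suc h))
  ends-at-B = begin
    last (map point (sweep up 0 h))       ≡⟨ last-map point (sweep up 0 h) ⟩
    Maybe.map point (last (sweep up 0 h)) ≡⟨ cong (Maybe.map point) (sweep-last up 0 h) ⟩
    just (+ (h + 0) , + 0)                ≡⟨ cong (λ a → just (+ a , + 0)) (+-identityʳ h) ⟩
    just (cornerB (suc h))                ∎
    where open ≡-Reasoning

  hamiltonian : HPath (suc h) (strokes up h)
  hamiltonian =
    subst (All (InGrid (suc h))) (sym visits)
      (All.map⁺ (All.tabulate (λ q∈ → triangle-in-grid h (sweep-⊆-triangle up 0 h q∈)))) ,
    subst Unique (sym visits) (Unique.map⁺ point-injective (sweep-unique up 0 h)) ,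
    (λ p p∈grid → subst (p ∈_) (sym visits) (grid-⊆-sweep h p p∈grid)) ,
    trans (cong last visits) ends-at-B
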